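{- Let $B>0$ and consider the head of a Turing machine with cell size $B$, whose head positions form a sequence $h(0),h(1),\dots$ in $B\mathbb{Z}$ with $h(t+1)-h(t)\in\{ -B,0,B\}$, and suppose it has the feathering property. Then for each $n\ge0$ and each point $x$: if during some time interval the head passes $2^n$ times to the right from point $x$, then during the same interval it reaches $x+nB$. The analogous statement holds for passing to the left (reaching $x-nB$).
   Context: A right-to-left turn at a point $y$ is a moment where the head, having moved right to $y$, next moves left from $y$ (and symmetrically for left-to-right turns). The feathering property ($1$-feathering) means: after a right-to-left turn at a point $x$, the next right-to-left turn at a point $\ge x$ must be at a point $\ge x+B$, and similarly, after a left-to-right turn at $x$, the next left-to-right turn at a point $\le x$ must be at a point $\le x-B$. Passing to the right from $x$ means a step of the head from $x$ to $x+B$ (passing to the left from $x$: a step from $x$ to $x-B$). -}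

module Defs where

open import Data.Nat using (ℕ; suc; _^_) renaming (_<_ to _<ℕ_; _≤_ to _≤ℕ_)
open import Data.Integer using (ℤ; +_; _+_; _-_; _*_; _≤_; _<_)
open import Data.Integer.Divisibility using (_∣_)
open import Data.Fin using (Fin)
open import Data.Product using (_×_; ∃)
open import Data.Sum using (_⊎_)
open import Relation.Binary.PropositionalEquality using (_≡_)
open import Function.Definitions using (Injective)

IsHead : (B : ℕ) → (ℕ → ℤ) → Set
IsHead B h =
  (∀ t → (+ B) ∣ h t) ×
  (∀ t → (h (suc t) ≡ h t - + B) ⊎ (h (suc t) ≡ h t) ⊎ (h (suc t) ≡ h t + + B))

RLTurn : (B : ℕ) → (ℕ → ℤ) → ℕ → ℤ → Set
RLTurn B h t y =
  h t ≡ y × h (suc t) ≡ y - + B ×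
  ∃ λ s → s <ℕ t × h (suc s) ≡ h s + + B × (∀ r → s <ℕ r → r ≤ℕ t → h r ≡ y)

LRTurn : (B : ℕ) → (ℕ → ℤ) → ℕ → ℤ → Set
LRTurn B h t y =
  h t ≡ y × h (suc t) ≡ y + + B ×
  ∃ λ s → s <ℕ t × h (suc s) ≡ h s - + B × (∀ r → s <ℕ r → r ≤ℕ t → h r ≡ y)

-- Feathering: after a RL turn at x (time t₁), the next RL turn (time t₂ > t₁) at a point
-- y ≥ x (i.e. no RL turn at a point ≥ x strictly in between) satisfies y ≥ x + B;
-- symmetrically for LR turns.
Feathering : (B : ℕ) → (ℕ → ℤ) → Set
Feathering B h =
  (∀ t₁ x t₂ y → RLTurn B h t₁ x → t₁ <ℕ t₂ → RLTurn B h t₂ y → x ≤ y →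
     (∀ t z → t₁ <ℕ t → t <ℕ t₂ → RLTurn B h t z → z < x) →
     x + + B ≤ y) ×
  (∀ t₁ x t₂ y → LRTurn B h t₁ x → t₁ <ℕ t₂ → LRTurn B h t₂ y → y ≤ x →
     (∀ t z → t₁ <ℕ t → t <ℕ t₂ → LRTurn B h t z → x < z) →
     y ≤ x - + B)

PassRight : (B : ℕ) → (ℕ → ℤ) → ℕ → ℤ → Set
PassRight B h t x = h t ≡ x × h (suc t) ≡ x + + B

PassLeft : (B : ℕ) → (ℕ → ℤ) → ℕ → ℤ → Set
PassLeft B h t x = h t ≡ x × h (suc t) ≡ x - + B

PassesRightTimes : (B : ℕ) → (ℕ → ℤ) → ℕ → ℕ → ℤ → ℕ → Set
PassesRightTimes B h a b x k =
  ∃ λ (τ : Fin k → ℕ) → Injective _≡_ _≡_ τ ×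
    (∀ i → a ≤ℕ τ i × suc (τ i) ≤ℕ b × PassRight B h (τ i) x)

PassesLeftTimes : (B : ℕ) → (ℕ → ℤ) → ℕ → ℕ → ℤ → ℕ → Set
PassesLeftTimes B h a b x k =
  ∃ λ (τ : Fin k → ℕ) → Injective _≡_ _≡_ τ ×
    (∀ i → a ≤ℕ τ i × suc (τ i) ≤ℕ b × PassLeft B h (τ i) x)

Reaches : (ℕ → ℤ) → ℕ → ℕ → ℤ → Set
Reaches h a b z = ∃ λ t → a ≤ℕ t × t ≤ℕ b × h t ≡ z

-- Between three passes to the right from x the head passes to the right from x + B.
-- Otherwise it stays on the lattice x + B − Bℕ, hence at or below x + B, throughout;
-- then each time it comes back from x + B to x it makes a right-to-left turn at x + B,
-- and two consecutive such turns (one before and one after the middle pass) violate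
-- feathering. So 2k + 1 passes from x yield k passes from x + B, and since a single pass
-- reaches x + B, 2ⁿ − 1 passes reach x + nB. Passing to the left is passing to the right
-- for the mirrored head t ↦ − h t.
module Submission where

open import Defs
open import Data.Nat using (ℕ; NonZero; _^_)
open import Data.Integer using (ℤ; +_; _+_; _-_; _*_)
open import Data.Product using (_×_)

open import Data.Nat using (zero; suc; s≤s; _≤′_; ≤′-refl; ≤′-step)
  renaming (_≤_ to _≤ℕ_; _<_ to _<ℕ_)
import Data.Nat as ℕ
import Data.Nat.Properties as ℕ
open import Data.Integer using (-_; _≤_; _<_; +<+)
import Data.Integer.Properties as ℤ
open import Data.Integer.Tactic.RingSolver using (solve-∀)
open import Data.Fin using (Fin; punchIn) renaming (zero to fzero)
open import Data.Fin.Properties using (any?; punchIn-injective; punchInᵢ≢i)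
open import Data.Product using (∃; _,_; proj₁; proj₂)
open import Data.Sum using (_⊎_; inj₁; inj₂)
open import Data.Empty using (⊥; ⊥-elim)
open import Function using (_∘′_; _$_)
open import Function.Definitions using (Injective)
open import Relation.Nullary using (¬_; yes; no; ¬?)
open import Relation.Nullary.Decidable using (decidable-stable; _×-dec_)
open import Relation.Unary using (Decidable)
open import Relation.Binary.PropositionalEquality

module _ {P : ℕ → Set} (P? : Decidable P) where

  lastBefore : ∀ {p q} → P p → p <ℕ q →
    ∃ λ s → p ≤ℕ s × s <ℕ q × P s × (∀ r → s <ℕ r → r <ℕ q → ¬ P r)
  lastBefore {q = suc q} Pp (s≤s p≤q) with P? q
  ... | yes Pq = q , p≤q , ℕ.≤-refl , Pq ,
        λ r q<r r<1+q → ⊥-elim (ℕ.<⇒≱ q<r (ℕ.s≤s⁻¹ r<1+q))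
  ... | no ¬Pq with lastBefore Pp (ℕ.≤∧≢⇒< p≤q (λ p≡q → ¬Pq (subst P p≡q Pp)))
  ...   | s , p≤s , s<q , Ps , none = s , p≤s , ℕ.m≤n⇒m≤1+n s<q , Ps , none′
    where
    none′ : ∀ r → s <ℕ r → r <ℕ suc q → ¬ P r
    none′ r s<r r<1+q with ℕ.m<1+n⇒m<n∨m≡n r<1+q
    ... | inj₁ r<q = none r s<r r<q
    ... | inj₂ refl = ¬Pq

data Chain (P : ℕ → Set) (a : ℕ) : ℕ → ℕ → Set where
  [] : ∀ {c} → Chain P a c 0
  snoc : ∀ {c k} t → Chain P a t k → a ≤ℕ t → t <ℕ c → P t → Chain P a c (suc k)

module _ {P : ℕ → Set} {a : ℕ} where

  weaken : ∀ {c c′ k} → c ≤ℕ c′ → Chain P a c k → Chain P a c′ k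
  weaken _ [] = []
  weaken c≤c′ (snoc t C a≤t t<c Pt) = snoc t C a≤t (ℕ.<-≤-trans t<c c≤c′) Pt

  dropLast : ∀ {c k} → Chain P a c (suc k) → Chain P a c k
  dropLast (snoc t C _ t<c _) = weaken (ℕ.<⇒≤ t<c) C

  private
    lower : ∀ {c t} → a ≤ℕ t × t <ℕ suc c × P t → t ≢ c → a ≤ℕ t × t <ℕ c × P t
    lower (a≤t , t<1+c , Pt) t≢c = a≤t , ℕ.≤∧≢⇒< (ℕ.s≤s⁻¹ t<1+c) t≢c , Pt

  fromInjective : ∀ c {k} (τ : Fin k → ℕ) → Injective _≡_ _≡_ τ →
    (∀ i → a ≤ℕ τ i × τ i <ℕ c × P (τ i)) → Chain P a c k
  fromInjective zero {zero} _ _ _ = []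
  fromInjective zero {suc k} τ _ inside with inside fzero
  ... | _ , () , _
  fromInjective (suc c) τ inj inside with any? (λ i → τ i ℕ.≟ c)
  fromInjective (suc c) {suc k} τ inj inside | yes (i , τi≡c) =
    snoc c (fromInjective c (λ j → τ (punchIn i j))
              (λ e → punchIn-injective i _ _ (inj e))
              (λ j → lower (inside (punchIn i j))
                           (λ τj≡c → punchInᵢ≢i i j (inj (trans τj≡c (sym τi≡c))))))
      (subst (a ≤ℕ_) τi≡c (proj₁ (inside i))) ℕ.≤-refl
      (subst P τi≡c (proj₂ (proj₂ (inside i))))
  ... | no τ≢c = weaken (ℕ.n≤1+n c)
                   (fromInjective c τ inj (λ j → lower (inside j) (λ e → τ≢c (j , e))))

UnitSteps : ℕ → (ℕ → ℤ) → Set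
UnitSteps B h = ∀ t → h (suc t) ≡ h t - + B ⊎ h (suc t) ≡ h t ⊎ h (suc t) ≡ h t + + B

RLFeathering : ℕ → (ℕ → ℤ) → Set
RLFeathering B h =
  ∀ t₁ x t₂ y → RLTurn B h t₁ x → t₁ <ℕ t₂ → RLTurn B h t₂ y → x ≤ y →
    (∀ t z → t₁ <ℕ t → t <ℕ t₂ → RLTurn B h t z → z < x) → x + + B ≤ y

x+b-b≡x : ∀ x b → x + b - b ≡ x
x+b-b≡x = solve-∀

x-b+b≡x : ∀ x b → x - b + b ≡ x
x-b+b≡x = solve-∀

neg-flip : ∀ {u v} → - u ≡ v → u ≡ - v
neg-flip {u} e = trans (sym (ℤ.neg-involutive u)) (cong -_ e)

neg-minus : ∀ u v → - (u - v) ≡ - u + v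
neg-minus u v = trans (ℤ.neg-distrib-+ u (- v)) (cong (λ z → - u + z) (ℤ.neg-involutive v))

neg-neg-plus : ∀ u v → - (- u + v) ≡ u - v
neg-neg-plus u v = trans (ℤ.neg-distrib-+ (- u) v) (cong (_- v) (ℤ.neg-involutive u))

mersenne : ℕ → ℕ
mersenne zero = 0
mersenne (suc n) = suc (mersenne n ℕ.+ mersenne n)

suc-mersenne : ∀ n → suc (mersenne n) ≡ 2 ^ n
suc-mersenne zero = refl
suc-mersenne (suc n) = begin
  suc (suc (mersenne n ℕ.+ mersenne n))  ≡⟨ cong suc (ℕ.+-suc (mersenne n) (mersenne n)) ⟨
  suc (mersenne n) ℕ.+ suc (mersenne n)  ≡⟨ cong₂ ℕ._+_ (suc-mersenne n) (suc-mersenne n) ⟩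
  2 ^ n ℕ.+ 2 ^ n                        ≡⟨ cong (2 ^ n ℕ.+_) (ℕ.+-identityʳ (2 ^ n)) ⟨
  2 ^ suc n                              ∎
  where open ≡-Reasoning

module RightPasses (B : ℕ) .{{_ : NonZero B}} (h : ℕ → ℤ)
                   (steps : UnitSteps B h) (feathering : RLFeathering B h) where

  b : ℤ
  b = + B

  y<y+b : ∀ y → y < y + b
  y<y+b y = subst (_< y + b) (ℤ.+-identityʳ y) (ℤ.+-monoʳ-< y (+<+ (ℕ.>-nonZero⁻¹ B)))

  y-b≢y : ∀ y → y - b ≢ y
  y-b≢y y e = ℤ.<-irrefl (trans (sym (x-b+b≡x y b)) (cong (_+ b) e)) (y<y+b y)

  LatticeBelow : ℤ → ℕ → Set
  LatticeBelow y t = ∃ λ k → h t ≡ y - + k * b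

  DownStep : ℤ → ℕ → Set
  DownStep y t = h t ≡ y × h (suc t) ≡ y - b

  downStep? : ∀ y → Decidable (DownStep y)
  downStep? y t = (h t ℤ.≟ y) ×-dec (h (suc t) ℤ.≟ y - b)

  passRight? : ∀ x → Decidable (λ t → PassRight B h t x)
  passRight? x t = (h t ℤ.≟ x) ×-dec (h (suc t) ℤ.≟ x + b)

  module Confined (y : ℤ) (p q : ℕ) (hp : h p ≡ y - b)
                  (noPass : ∀ t → p ≤ℕ t → t <ℕ q → ¬ PassRight B h t y) where

    onLattice : ∀ {r} → p ≤′ r → r ≤ℕ q → LatticeBelow y r
    onLattice ≤′-refl _ = 1 , trans hp (cong (λ z → y - z) (sym (ℤ.*-identityˡ b)))
    onLattice {suc r} (≤′-step p≤′r) r<q with onLattice p≤′r (ℕ.<⇒≤ r<q) | steps r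
    ... | k , hr | inj₁ down = suc k , trans down (trans (cong (_- b) hr) (sub-step y (+ k) b))
      where
      sub-step : ∀ y k b → y - k * b - b ≡ y - (+ 1 + k) * b
      sub-step = solve-∀
    ... | k , hr | inj₂ (inj₁ stay) = k , trans stay hr
    ... | zero , hr | inj₂ (inj₂ up) =
      ⊥-elim (noPass r (ℕ.≤′⇒≤ p≤′r) r<q (hr′ , trans up (cong (_+ b) hr′)))
      where
      hr′ : h r ≡ y
      hr′ = trans hr (ℤ.+-identityʳ y)
    ... | suc k , hr | inj₂ (inj₂ up) = k , trans up (trans (cong (_+ b) hr) (add-step y (+ k) b))
      where
      add-step : ∀ y k b → y - (+ 1 + k) * b + b ≡ y - k * b
      add-step = solve-∀

    below : ∀ {r} → p ≤ℕ r → r ≤ℕ q → h r ≤ y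
    below p≤r r≤q with onLattice (ℕ.≤⇒≤′ p≤r) r≤q
    ... | k , hr = subst (_≤ y) (sym (trans hr (cong (λ j → y - j) (sym (ℤ.pos-* k B)))))
                         (ℤ.i-j≤i y (+ (k ℕ.* B)))

    leavesDown : ∀ {s} → p ≤ℕ s → s <ℕ q → h s ≡ y → h (suc s) ≢ y → h (suc s) ≡ y - b
    leavesDown {s} p≤s s<q hs h1+s≢y with steps s
    ... | inj₁ down = trans down (cong (_- b) hs)
    ... | inj₂ (inj₁ stay) = ⊥-elim (h1+s≢y (trans stay hs))
    ... | inj₂ (inj₂ up) = ⊥-elim (noPass s p≤s s<q (hs , trans up (cong (_+ b) hs)))

    downStepBetween : ∀ {s t} → p ≤ℕ s → s ≤ℕ t → t ≤ℕ q → h s ≡ y → h t ≢ y →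
      ∃ λ u → s ≤ℕ u × u <ℕ t × DownStep y u
    downStepBetween {s} {t} p≤s s≤t t≤q hs ht≢y
      with lastBefore (λ n → h n ℤ.≟ y) hs (ℕ.≤∧≢⇒< s≤t λ { refl → ht≢y hs })
    ... | u , s≤u , u<t , hu , after =
      u , s≤u , u<t , hu , leavesDown (ℕ.≤-trans p≤s s≤u) (ℕ.<-≤-trans u<t t≤q) hu h1+u≢y
      where
      h1+u≢y : h (suc u) ≢ y
      h1+u≢y with ℕ.m≤n⇒m<n∨m≡n u<t
      ... | inj₁ 1+u<t = after (suc u) (ℕ.n<1+n u) 1+u<t
      ... | inj₂ refl = ht≢y

    downStep⇒RLTurn : ∀ {t} → p <ℕ t → t ≤ℕ q → DownStep y t → RLTurn B h t y
    downStep⇒RLTurn {t} p<t t≤q (ht , h1+t)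
      with lastBefore (λ n → ¬? (h n ℤ.≟ y)) (λ hp≡y → y-b≢y y (trans (sym hp) hp≡y)) p<t
    ... | s , p≤s , s<t , hs≢y , after = ht , h1+t , s , s<t , arrives , atY
      where
      atY : ∀ r → s <ℕ r → r ≤ℕ t → h r ≡ y
      atY r s<r r≤t with ℕ.m≤n⇒m<n∨m≡n r≤t
      ... | inj₁ r<t = decidable-stable (h r ℤ.≟ y) (after r s<r r<t)
      ... | inj₂ refl = ht

      -- The head never rises above y, so it can only have arrived at y by a step up.
      arrives : h (suc s) ≡ h s + b
      arrives with steps s
      ... | inj₁ down =
        ⊥-elim (ℤ.≤⇒≯ (subst (_≤ y) hs≡y+b (below p≤s (ℕ.<⇒≤ (ℕ.<-≤-trans s<t t≤q)))) (y<y+b y))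
        where
        hs≡y+b : h s ≡ y + b
        hs≡y+b = trans (sym (x-b+b≡x (h s) b))
                   (cong (_+ b) (trans (sym down) (atY (suc s) (ℕ.n<1+n s) s<t)))
      ... | inj₂ (inj₁ stay) = ⊥-elim (hs≢y (trans (sym stay) (atY (suc s) (ℕ.n<1+n s) s<t)))
      ... | inj₂ (inj₂ up) = up

    noMiddlePass : ∀ {m} → p <ℕ m → m <ℕ q → h (suc p) ≡ y →
      h m ≡ y - b → h (suc m) ≡ y → h q ≡ y - b → ⊥
    noMiddlePass p<m m<q h1+p hm h1+m hq
      with downStepBetween (ℕ.n≤1+n p) p<m (ℕ.<⇒≤ m<q) h1+p (y-b≢y y ∘′ trans (sym hm))
         | downStepBetween (ℕ.≤-trans (ℕ.n≤1+n p) (ℕ.m≤n⇒m≤1+n p<m)) m<q ℕ.≤-refl h1+m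
                           (y-b≢y y ∘′ trans (sym hq))
    ... | s₁ , p<s₁ , s₁<m , D₁ | s₂ , m<s₂ , s₂<q , D₂
      with lastBefore (downStep? y) D₁ (ℕ.<-trans s₁<m m<s₂)
    ... | t₁ , s₁≤t₁ , t₁<s₂ , T₁ , after =
      ℤ.<-irrefl refl
        (ℤ.<-≤-trans (y<y+b y) (feathering t₁ y s₂ y turn₁ t₁<s₂ turn₂ ℤ.≤-refl between))
      where
      p<t₁ : p <ℕ t₁
      p<t₁ = ℕ.<-≤-trans p<s₁ s₁≤t₁

      turn₁ : RLTurn B h t₁ y
      turn₁ = downStep⇒RLTurn p<t₁ (ℕ.<⇒≤ (ℕ.<-trans t₁<s₂ s₂<q)) T₁

      turn₂ : RLTurn B h s₂ y
      turn₂ = downStep⇒RLTurn (ℕ.<-trans p<m m<s₂) (ℕ.<⇒≤ s₂<q) D₂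

      between : ∀ t z → t₁ <ℕ t → t <ℕ s₂ → RLTurn B h t z → z < y
      between t z t₁<t t<s₂ (ht , h1+t , _) =
        ℤ.≤∧≢⇒< (subst (_≤ y) ht (below (ℕ.<⇒≤ (ℕ.<-trans p<t₁ t₁<t))
                                        (ℕ.<⇒≤ (ℕ.<-trans t<s₂ s₂<q))))
                λ { refl → after t t₁<t t<s₂ (ht , h1+t) }

  passAbove : ∀ {x p₁ p₂ p₃} → p₁ <ℕ p₂ → p₂ <ℕ p₃ →
    PassRight B h p₁ x → PassRight B h p₂ x → PassRight B h p₃ x →
    ∃ λ q → p₁ <ℕ q × q <ℕ p₃ × PassRight B h q (x + b)
  passAbove {x} {p₁} {p₃ = p₃} p₁<p₂ p₂<p₃ (hp₁ , h1+p₁) (hp₂ , h1+p₂) (hp₃ , _)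
    with ℕ.anyUpTo? (λ t → (p₁ ℕ.≤? t) ×-dec passRight? (x + b) t) p₃
  ... | yes (q , q<p₃ , p₁≤q , Q) =
    q , ℕ.≤∧≢⇒< p₁≤q (λ { refl → y-b≢y (x + b) (trans (x+b-b≡x x b) (trans (sym hp₁) (proj₁ Q))) })
      , q<p₃ , Q
  ... | no none =
    ⊥-elim $ Confined.noMiddlePass (x + b) p₁ p₃ (atX hp₁)
      (λ t p₁≤t t<p₃ Q → none (t , t<p₃ , p₁≤t , Q)) p₁<p₂ p₂<p₃ h1+p₁ (atX hp₂) h1+p₂ (atX hp₃)
    where
    atX : ∀ {t} → h t ≡ x → h t ≡ x + b - b
    atX ht = trans ht (sym (x+b-b≡x x b))

  PassRightChain : ℤ → ℕ → ℕ → ℕ → Set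
  PassRightChain x = Chain (λ t → PassRight B h t x)

  halve : ∀ m {x a c} → PassRightChain x a c (suc (m ℕ.+ m)) → PassRightChain (x + b) a c m
  halve zero _ = []
  halve (suc m) {x} {a} {c} C with subst (λ k → PassRightChain x a c (suc (suc k))) (ℕ.+-suc m m) C
  ... | snoc p₃ (snoc p₂ (snoc p₁ C₀ a≤p₁ p₁<p₂ P₁) _ p₂<p₃ P₂) _ p₃<c P₃
    with passAbove p₁<p₂ p₂<p₃ P₁ P₂ P₃
  ... | q , p₁<q , q<p₃ , Q =
    snoc q (weaken p₁<q (halve m (snoc p₁ C₀ a≤p₁ ℕ.≤-refl P₁)))
      (ℕ.≤-trans a≤p₁ (ℕ.<⇒≤ p₁<q)) (ℕ.<-trans q<p₃ p₃<c) Q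

  reachFromChain : ∀ n {x a c} → PassRightChain x a c (mersenne (suc n)) →
    Reaches h a c (x + + suc n * b)
  reachFromChain zero {x} (snoc t [] a≤t t<c (_ , h1+t)) =
    suc t , ℕ.m≤n⇒m≤1+n a≤t , t<c , trans h1+t (cong (λ z → x + z) (sym (ℤ.*-identityˡ b)))
  reachFromChain (suc n) {x} {a} {c} C
    with reachFromChain n (halve (mersenne (suc n)) C)
  ... | t , a≤t , t≤c , ht = t , a≤t , t≤c , trans ht (one-more x (+ n) b)
    where
    one-more : ∀ x n b → x + b + (+ 1 + n) * b ≡ x + (+ 1 + (+ 1 + n)) * b
    one-more = solve-∀

  reachRight : ∀ n {x a c} → PassesRightTimes B h a c x (2 ^ n) → Reaches h a c (x + + n * b)
  reachRight zero {x} (τ , _ , inside) with inside fzero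
  ... | a≤t , t<c , ht , _ = τ fzero , a≤t , ℕ.<⇒≤ t<c , trans ht (sym (ℤ.+-identityʳ x))
  reachRight (suc n) {x} {a} {c} (τ , inj , inside) =
    reachFromChain n (dropLast (subst (PassRightChain x a c) (sym (suc-mersenne (suc n)))
                                      (fromInjective c τ inj inside)))

module Mirror (B : ℕ) (h : ℕ → ℤ) where

  mirror : ℕ → ℤ
  mirror t = - h t

  mirror-unitSteps : UnitSteps B h → UnitSteps B mirror
  mirror-unitSteps steps t with steps t
  ... | inj₁ down = inj₂ (inj₂ (trans (cong -_ down) (neg-minus (h t) (+ B))))
  ... | inj₂ (inj₁ stay) = inj₂ (inj₁ (cong -_ stay))
  ... | inj₂ (inj₂ up) = inj₁ (trans (cong -_ up) (ℤ.neg-distrib-+ (h t) (+ B)))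

  RLTurn-mirror⇒LRTurn : ∀ {t y} → RLTurn B mirror t y → LRTurn B h t (- y)
  RLTurn-mirror⇒LRTurn {y = y} (ht , h1+t , s , s<t , arrives , atY) =
    neg-flip ht , trans (neg-flip h1+t) (neg-minus y (+ B)) , s , s<t ,
    trans (neg-flip arrives) (neg-neg-plus (h s) (+ B)) , λ r s<r r≤t → neg-flip (atY r s<r r≤t)

  LRTurn⇒RLTurn-mirror : ∀ {t z} → LRTurn B h t z → RLTurn B mirror t (- z)
  LRTurn⇒RLTurn-mirror {z = z} (ht , h1+t , s , s<t , arrives , atZ) =
    cong -_ ht , trans (cong -_ h1+t) (ℤ.neg-distrib-+ z (+ B)) , s , s<t ,
    trans (cong -_ arrives) (neg-minus (h s) (+ B)) , λ r s<r r≤t → cong -_ (atZ r s<r r≤t)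

  mirror-RLFeathering : Feathering B h → RLFeathering B mirror
  mirror-RLFeathering (_ , featheringLR) t₁ x t₂ y T₁ t₁<t₂ T₂ x≤y between =
    ℤ.neg-cancel-≤ $ subst (- y ≤_) (sym (ℤ.neg-distrib-+ x (+ B))) $
    featheringLR t₁ (- x) t₂ (- y)
      (RLTurn-mirror⇒LRTurn T₁) t₁<t₂ (RLTurn-mirror⇒LRTurn T₂) (ℤ.neg-mono-≤ x≤y)
      (λ t z t₁<t t<t₂ T → subst (- x <_) (ℤ.neg-involutive z)
                             (ℤ.neg-mono-< (between t (- z) t₁<t t<t₂ (LRTurn⇒RLTurn-mirror T))))

  mirror-passesRight : ∀ {a c x k} →
    PassesLeftTimes B h a c x k → PassesRightTimes B mirror a c (- x) k
  mirror-passesRight {x = x} (τ , inj , inside) = τ , inj , λ i → mirrorPass (inside i)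
    where
    mirrorPass : ∀ {a c t} → a ≤ℕ t × t <ℕ c × PassLeft B h t x →
      a ≤ℕ t × t <ℕ c × PassRight B mirror t (- x)
    mirrorPass (a≤t , t<c , ht , h1+t) =
      a≤t , t<c , cong -_ ht , trans (cong -_ h1+t) (neg-minus x (+ B))

  reaches-mirror : ∀ {a c x m} → Reaches mirror a c (- x + m) → Reaches h a c (x - m)
  reaches-mirror {x = x} {m} (t , a≤t , t≤c , ht) =
    t , a≤t , t≤c , trans (neg-flip ht) (neg-neg-plus x m)

mainTheorem5 : (B : ℕ) → NonZero B → (h : ℕ → ℤ) → IsHead B h → Feathering B h →
    (n : ℕ) (x : ℤ) (a b : ℕ) →
    (PassesRightTimes B h a b x (2 ^ n) → Reaches h a b (x + (+ n) * (+ B))) ×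
    (PassesLeftTimes B h a b x (2 ^ n) → Reaches h a b (x - (+ n) * (+ B)))
mainTheorem5 B nonZero h (_ , steps) feathering n x a c =
  RightPasses.reachRight B {{nonZero}} h steps (proj₁ feathering) n ,
  λ passesLeft → reaches-mirror {x = x}
    (RightPasses.reachRight B {{nonZero}} mirror
       (mirror-unitSteps steps) (mirror-RLFeathering feathering) n (mirror-passesRight passesLeft))
  where open Mirror B h
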